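{- Let $q,r$ be finite nonempty words of the same length. The couple $(q,r)$ is definite if and only if every biinfinite word having $q$ as a quasiperiod contains infinitely many occurrences of $r$.
   Context: Biinfinite words are indexed by $\mathbb{Z}$; a finite word $u$ is a quasiperiod of $\mathbf{w}$ if every position of $\mathbf{w}$ lies in an occurrence of $u$. For a finite word $q$, an overlap of $q$ is a word $w$ with $q$ as prefix and suffix and $|q|<|w|\le 2|q|$, of span $2|q|-|w|$; $\mathcal{V}_q(m)$ is the overlap of span $m$. If $\mathcal{V}_q(m)=u$ and $\mathcal{V}_q(n)=qv$ then $\mathcal{V}_q(m,n)=uv$. $\mathcal{V}^*_q(m)$ (resp. $\mathcal{V}^*_q(m,n)$) means it exists and contains exactly two (resp. three) occurrences of $q$. $\mathrm{occ}(q,r,m)$ is the position of the occurrence of $r$ in $\mathcal{V}^*_q(m)$ if this exists and contains $r$ as a factor, else undefined; $f_{q,r}(m,n)=m+\mathrm{occ}(q,r,m)-\mathrm{occ}(q,r,n)$ if both are defined, else undefined. The couple $(q,r)$ is definite if $f_{q,r}(m,n)$ is defined for all integers $m,n$ such that $\mathcal{V}^*_q(m,n)$ exists. -}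

module Defs where

open import Data.Nat using (ℕ; _<_; _≤_; _*_; _∸_)
open import Data.Integer as ℤ using (ℤ; +_; ∣_∣)
open import Data.List using (List; []; length; take; drop; _++_; lookup)
open import Data.Fin using (Fin; toℕ)
open import Data.Product using (Σ; ∃; ∃-syntax; _×_)
open import Data.Sum using (_⊎_)
open import Relation.Binary.PropositionalEquality using (_≡_)

module _ {A : Set} where

  OccAt : List A → List A → ℕ → Set
  OccAt u w i = take (length u) (drop i w) ≡ u × length u Data.Nat.+ i ≤ length w

  ExactlyTwoOcc : List A → List A → Set
  ExactlyTwoOcc q w =
    ∃[ i ] ∃[ j ] (i < j × OccAt q w i × OccAt q w j
      × (∀ k → OccAt q w k → k ≡ i ⊎ k ≡ j))

  ExactlyThreeOcc : List A → List A → Set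
  ExactlyThreeOcc q w =
    ∃[ i ] ∃[ j ] ∃[ k ] (i < j × j < k × OccAt q w i × OccAt q w j × OccAt q w k
      × (∀ l → OccAt q w l → l ≡ i ⊎ l ≡ j ⊎ l ≡ k))

  IsOverlap : List A → List A → Set
  IsOverlap q w =
    take (length q) w ≡ q × drop (length w ∸ length q) w ≡ q
    × length q < length w × length w ≤ 2 * length q

  span : List A → List A → ℤ
  span q w = + (2 * length q) ℤ.- + length w

  𝒱 : List A → ℤ → List A → Set
  𝒱 q m w = IsOverlap q w × span q w ≡ m

  𝒱* : List A → ℤ → List A → Set
  𝒱* q m w = 𝒱 q m w × ExactlyTwoOcc q w

  𝒱₂ : List A → ℤ → ℤ → List A → Set
  𝒱₂ q m n w = ∃[ u ] ∃[ v ] (𝒱 q m u × 𝒱 q n (q ++ v) × w ≡ u ++ v)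

  𝒱*₂ : List A → ℤ → ℤ → List A → Set
  𝒱*₂ q m n w = 𝒱₂ q m n w × ExactlyThreeOcc q w

  Occ : List A → List A → ℤ → ℕ → Set
  Occ q r m i = ∃[ w ] (𝒱* q m w × OccAt r w i)

  OccDefined : List A → List A → ℤ → Set
  OccDefined q r m = ∃[ i ] Occ q r m i

  -- f_{q,r}(m,n) is defined (iff occ(q,r,m) and occ(q,r,n) are both defined)
  FDefined : List A → List A → ℤ → ℤ → Set
  FDefined q r m n = OccDefined q r m × OccDefined q r n

  Definite : List A → List A → Set
  Definite q r = ∀ (m n : ℤ) → (∃[ w ] 𝒱*₂ q m n w) → FDefined q r m n

  OccAtℤ : List A → (ℤ → A) → ℤ → Set
  OccAtℤ u x j = ∀ (k : Fin (length u)) → x (j ℤ.+ + toℕ k) ≡ lookup u k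

  Quasiperiod : List A → (ℤ → A) → Set
  Quasiperiod u x = ∀ (i : ℤ) → ∃[ j ] (j ℤ.≤ i × i ℤ.< j ℤ.+ + length u × OccAtℤ u x j)

  InfinitelyManyOcc : List A → (ℤ → A) → Set
  InfinitelyManyOcc r x = ∀ (N : ℕ) → ∃[ j ] (N ≤ ∣ j ∣ × OccAtℤ r x j)

module Submission where

-- An overlap z of q has period p = |z| - |q| ≤ |q|, so the p-periodic biinfinite extension of z has
-- q as a quasiperiod, and since |r| ≤ |q| every occurrence of r in it can be moved, modulo p, to an
-- occurrence inside z. Applied to the two overlaps composing 𝒱*_q(m,n), this turns "every
-- q-quasiperiodic word contains r" into definiteness.
-- Conversely, in a q-quasiperiodic word consecutive occurrences of q are at most |q| apart, so beyond
-- any bound there are three consecutive occurrences. They span some 𝒱*_q(m,n), and as an overlap is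
-- determined by its span, definiteness places r inside the factor spanned by the first two.

open import Defs
open import Data.Nat using (_<_)
import Data.Integer
open import Data.List using (List; length)
open import Relation.Binary.Definitions using (DecidableEquality)
open import Relation.Binary.PropositionalEquality using (_≡_)
open import Function.Bundles using (_⇔_; mk⇔)

open import Data.Nat as ℕ using (ℕ; zero; suc; _+_; _*_; _∸_; _≤_; z≤n; s≤s; NonZero; >-nonZero)
open import Data.Nat.DivMod
  using (_%_; _/_; m≡m%n+[m/n]*n; m%n<n; m%n≤m; m*n%n≡0; m%n%n≡m%n; %-distribˡ-+; [m+kn]%n≡m%n)
open import Data.Nat.Properties
open import Algebra.Properties.CommutativeSemigroup +-commutativeSemigroup using (x∙yz≈y∙xz)
open import Data.Integer as ℤ using (ℤ)
import Data.Integer.Properties as ℤ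
open import Algebra.Properties.CommutativeSemigroup ℤ.+-commutativeSemigroup using (xy∙z≈xz∙y)
open import Data.List using ([]; _∷_; take; drop; _++_; lookup; applyUpTo)
open import Data.List.Properties using (length-take; length-drop; length-applyUpTo; length-++; take-all)
open import Data.Fin as Fin using (Fin; toℕ; fromℕ<)
open import Data.Fin.Properties using (toℕ-fromℕ<; toℕ<n)
open import Data.Product as Product using (_×_; _,_; proj₁; proj₂; ∃-syntax)
open import Data.Sum as Sum using (_⊎_; inj₁; inj₂)
open import Data.Empty using (⊥-elim)
open import Relation.Binary.PropositionalEquality
open import Relation.Binary.Definitions using (tri<; tri≈; tri>)
open import Relation.Nullary using (Dec; yes; no; ¬_; contradiction)

least-witness : ∀ {P : ℕ → Set} → (∀ k → Dec (P k)) → ∀ {n} → P n →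
                ∃[ m ] P m × m ≤ n × (∀ {k} → k < m → ¬ P k)
least-witness P? {zero} P0 = 0 , P0 , z≤n , λ ()
least-witness P? {suc n} Pn with P? 0
... | yes P0 = 0 , P0 , z≤n , λ ()
... | no ¬P0 with m , Pm , m≤n , below ← least-witness (λ k → P? (suc k)) Pn =
  suc m , Pm , s≤s m≤n , λ { {zero} _ → ¬P0 ; {suc k} (s≤s k<m) → below k<m }

exactly-three-members : ∀ {P : ℕ → Set} {i j l a b} → i < j → j < l → P l →
  (∀ k → P k → k ≡ i ⊎ k ≡ j ⊎ k ≡ l) →
  P 0 → P a → P b → 0 < a → a < b → (∀ {k} → P k → k ≤ b) →
  ∀ k → P k → k ≡ 0 ⊎ k ≡ a ⊎ k ≡ b
exactly-three-members {_} {i} {j} {l} {a} {b} i<j j<l Pl three P0 Pa Pb 0<a a<b bounded k Pk =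
  Sum.map (λ k≡i → trans k≡i i≡0) (Sum.map (λ k≡j → trans k≡j j≡a) (λ k≡l → trans k≡l l≡b)) (three k Pk)
  where
  i≡0 : i ≡ 0
  i≡0 with three 0 P0
  ... | inj₁ 0≡i        = sym 0≡i
  ... | inj₂ (inj₁ 0≡j) = contradiction (subst (i <_) (sym 0≡j) i<j) n≮0
  ... | inj₂ (inj₂ 0≡l) = contradiction (subst (i <_) (sym 0≡l) (<-trans i<j j<l)) n≮0
  b≤l : b ≤ l
  b≤l with three b Pb
  ... | inj₁ b≡i        = subst (_≤ l) (sym b≡i) (<⇒≤ (<-trans i<j j<l))
  ... | inj₂ (inj₁ b≡j) = subst (_≤ l) (sym b≡j) (<⇒≤ j<l)
  ... | inj₂ (inj₂ b≡l) = ≤-reflexive b≡l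
  l≡b : l ≡ b
  l≡b = ≤-antisym (bounded Pl) b≤l
  j≡a : j ≡ a
  j≡a with three a Pa
  ... | inj₁ a≡i        = contradiction (trans a≡i i≡0) (>⇒≢ 0<a)
  ... | inj₂ (inj₁ a≡j) = sym a≡j
  ... | inj₂ (inj₂ a≡l) = contradiction (trans a≡l l≡b) (<⇒≢ a<b)

%-absorbˡ : ∀ m k p .{{_ : NonZero p}} → (m % p + k) % p ≡ (m + k) % p
%-absorbˡ m k p = begin
  (m % p + k) % p            ≡⟨ %-distribˡ-+ (m % p) k p ⟩
  (m % p % p + k % p) % p    ≡⟨ cong (λ t → (t + k % p) % p) (m%n%n≡m%n m p) ⟩
  (m % p + k % p) % p        ≡⟨ %-distribˡ-+ m k p ⟨
  (m + k) % p                ∎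
  where open ≡-Reasoning

i<i-t+n : ∀ i {t n} → t < n → i ℤ.< i ℤ.- ℤ.+ t ℤ.+ ℤ.+ n
i<i-t+n i {t} {n} t<n = subst (i ℤ.<_) (sym i-t+n≡i+[n∸t])
  (subst (ℤ._< i ℤ.+ ℤ.+ (n ∸ t)) (ℤ.+-identityʳ i) (ℤ.+-monoʳ-< i (ℤ.+<+ (m<n⇒0<n∸m t<n))))
  where
  open ≡-Reasoning
  i-t+n≡i+[n∸t] : i ℤ.- ℤ.+ t ℤ.+ ℤ.+ n ≡ i ℤ.+ ℤ.+ (n ∸ t)
  i-t+n≡i+[n∸t] = begin
    i ℤ.- ℤ.+ t ℤ.+ ℤ.+ n         ≡⟨ ℤ.+-assoc i (ℤ.- ℤ.+ t) (ℤ.+ n) ⟩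
    i ℤ.+ (ℤ.- ℤ.+ t ℤ.+ ℤ.+ n)   ≡⟨ cong (ℤ._+_ i) (ℤ.+-comm (ℤ.- ℤ.+ t) (ℤ.+ n)) ⟩
    i ℤ.+ (ℤ.+ n ℤ.- ℤ.+ t)       ≡⟨ cong (ℤ._+_ i) (ℤ.m-n≡m⊖n n t) ⟩
    i ℤ.+ (n ℤ.⊖ t)               ≡⟨ cong (ℤ._+_ i) (ℤ.⊖-≥ (<⇒≤ t<n)) ⟩
    i ℤ.+ ℤ.+ (n ∸ t)             ∎

module Residue (p : ℕ) .{{_ : NonZero p}} where

  natRep : ∀ j → ∃[ n ] j ℤ.+ ℤ.+ (ℤ.∣ j ∣ * p) ≡ ℤ.+ n
  natRep (ℤ.+ n)    = n + n * p , refl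
  natRep ℤ.-[1+ n ] = suc n * p ∸ suc n , ℤ.⊖-≥ (m≤m*n (suc n) p)

  residue : ℤ → ℕ
  residue j = proj₁ (natRep j) % p

  residue<p : ∀ j → residue j < p
  residue<p j = m%n<n (proj₁ (natRep j)) p

  residue-of : ∀ j K {a} → j ℤ.+ ℤ.+ (K * p) ≡ ℤ.+ a → residue j ≡ a % p
  residue-of j K {a} eq = begin
    n % p             ≡⟨ [m+kn]%n≡m%n n K p ⟨
    (n + K * p) % p   ≡⟨ cong (_% p) (ℤ.+-injective same) ⟨
    (a + ∣j∣p) % p    ≡⟨ [m+kn]%n≡m%n a ℤ.∣ j ∣ p ⟩
    a % p             ∎
    where
    open ≡-Reasoning
    n : ℕ
    n = proj₁ (natRep j)
    ∣j∣p : ℕ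
    ∣j∣p = ℤ.∣ j ∣ * p
    same : ℤ.+ (a + ∣j∣p) ≡ ℤ.+ (n + K * p)
    same = begin
      ℤ.+ (a + ∣j∣p)                  ≡⟨ ℤ.pos-+ a ∣j∣p ⟩
      ℤ.+ a ℤ.+ ℤ.+ ∣j∣p              ≡⟨ cong (ℤ._+ ℤ.+ ∣j∣p) eq ⟨
      j ℤ.+ ℤ.+ (K * p) ℤ.+ ℤ.+ ∣j∣p  ≡⟨ xy∙z≈xz∙y j (ℤ.+ (K * p)) (ℤ.+ ∣j∣p) ⟩
      j ℤ.+ ℤ.+ ∣j∣p ℤ.+ ℤ.+ (K * p)  ≡⟨ cong (ℤ._+ ℤ.+ (K * p)) (proj₂ (natRep j)) ⟩
      ℤ.+ (n + K * p)                 ∎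

  residue-+ : ∀ j k → residue (j ℤ.+ ℤ.+ k) ≡ (residue j + k) % p
  residue-+ j k = trans (residue-of (j ℤ.+ ℤ.+ k) ℤ.∣ j ∣ shifted) (sym (%-absorbˡ (proj₁ (natRep j)) k p))
    where
    shifted : j ℤ.+ ℤ.+ k ℤ.+ ℤ.+ (ℤ.∣ j ∣ * p) ≡ ℤ.+ (proj₁ (natRep j) + k)
    shifted = trans (xy∙z≈xz∙y j (ℤ.+ k) (ℤ.+ (ℤ.∣ j ∣ * p))) (cong (ℤ._+ ℤ.+ k) (proj₂ (natRep j)))

  residue[j-residue]≡0 : ∀ j → residue (j ℤ.- ℤ.+ residue j) ≡ 0
  residue[j-residue]≡0 j = begin
    residue (j ℤ.- ℤ.+ t)  ≡⟨ residue-of (j ℤ.- ℤ.+ t) ℤ.∣ j ∣ shifted ⟩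
    (n ∸ t) % p            ≡⟨ cong (_% p) n∸t≡[n/p]*p ⟩
    (n / p * p) % p        ≡⟨ m*n%n≡0 (n / p) p ⟩
    0                      ∎
    where
    open ≡-Reasoning
    n : ℕ
    n = proj₁ (natRep j)
    t : ℕ
    t = residue j
    shifted : j ℤ.- ℤ.+ t ℤ.+ ℤ.+ (ℤ.∣ j ∣ * p) ≡ ℤ.+ (n ∸ t)
    shifted = begin
      j ℤ.- ℤ.+ t ℤ.+ ℤ.+ (ℤ.∣ j ∣ * p)   ≡⟨ xy∙z≈xz∙y j (ℤ.- ℤ.+ t) (ℤ.+ (ℤ.∣ j ∣ * p)) ⟩
      j ℤ.+ ℤ.+ (ℤ.∣ j ∣ * p) ℤ.- ℤ.+ t   ≡⟨ cong (ℤ._- ℤ.+ t) (proj₂ (natRep j)) ⟩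
      ℤ.+ n ℤ.- ℤ.+ t                     ≡⟨ ℤ.m-n≡m⊖n n t ⟩
      n ℤ.⊖ t                             ≡⟨ ℤ.⊖-≥ (m%n≤m n p) ⟩
      ℤ.+ (n ∸ t)                         ∎
    n∸t≡[n/p]*p : n ∸ t ≡ n / p * p
    n∸t≡[n/p]*p = trans (cong (_∸ t) (m≡m%n+[m/n]*n n p)) (m+n∸m≡n t (n / p * p))

module Indexing {A : Set} (default : A) where

  infixl 5 _!_

  -- Positions past the end read the default letter, so that !-drop needs no bound.
  _!_ : List A → ℕ → A
  []      ! _     = default
  (a ∷ _) ! zero  = a
  (_ ∷ w) ! suc k = w ! k

  !-take : ∀ n w {k} → k < n → take n w ! k ≡ w ! k
  !-take (suc n) []      _       = refl
  !-take (suc n) (a ∷ w) {zero}  _       = refl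
  !-take (suc n) (a ∷ w) {suc k} (s≤s k<n) = !-take n w k<n

  !-drop : ∀ n w k → drop n w ! k ≡ w ! (n + k)
  !-drop zero    w       k = refl
  !-drop (suc n) []      k = refl
  !-drop (suc n) (a ∷ w) k = !-drop n w k

  !-++ˡ : ∀ u v {k} → k < length u → (u ++ v) ! k ≡ u ! k
  !-++ˡ (a ∷ u) v {zero}  _         = refl
  !-++ˡ (a ∷ u) v {suc k} (s≤s k<u) = !-++ˡ u v k<u

  !-applyUpTo : ∀ (f : ℕ → A) n {k} → k < n → applyUpTo f n ! k ≡ f k
  !-applyUpTo f (suc n) {zero}  _         = refl
  !-applyUpTo f (suc n) {suc k} (s≤s k<n) = !-applyUpTo (λ i → f (suc i)) n k<n

  lookup≡! : ∀ u (k : Fin (length u)) → lookup u k ≡ u ! toℕ k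
  lookup≡! (a ∷ u) Fin.zero    = refl
  lookup≡! (a ∷ u) (Fin.suc k) = lookup≡! u k

  !-ext : ∀ v w → length v ≡ length w → (∀ {k} → k < length v → v ! k ≡ w ! k) → v ≡ w
  !-ext []      []      _  _  = refl
  !-ext (a ∷ v) (b ∷ w) eq pt =
    cong₂ _∷_ (pt (s≤s z≤n)) (!-ext v w (suc-injective eq) (λ k<v → pt (s≤s k<v)))

  applyUpTo-++ : ∀ (f : ℕ → A) m n → applyUpTo f (m + n) ≡ applyUpTo f m ++ applyUpTo (λ k → f (m + k)) n
  applyUpTo-++ f zero    n = refl
  applyUpTo-++ f (suc m) n = cong (f 0 ∷_) (applyUpTo-++ (λ k → f (suc k)) m n)

  Matches : List A → (ℕ → A) → Set
  Matches u f = ∀ {k} → k < length u → f k ≡ u ! k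

  matches-cong : ∀ {u f g} → (∀ k → f k ≡ g k) → Matches u f → Matches u g
  matches-cong f≗g m k<u = trans (sym (f≗g _)) (m k<u)

  occAt⇒matches : ∀ {u w i} → OccAt u w i → Matches u (λ k → w ! (i + k))
  occAt⇒matches {u} {w} {i} (eq , _) {k} k<u = begin
    w ! (i + k)                        ≡⟨ !-drop i w k ⟨
    drop i w ! k                       ≡⟨ !-take (length u) (drop i w) k<u ⟨
    take (length u) (drop i w) ! k     ≡⟨ cong (_! k) eq ⟩
    u ! k                              ∎
    where open ≡-Reasoning

  matches⇒occAt : ∀ {u w i} → length u + i ≤ length w → Matches u (λ k → w ! (i + k)) → OccAt u w i
  matches⇒occAt {u} {w} {i} fits m = !-ext _ u length-window pointwise , fits
    where
    length-window : length (take (length u) (drop i w)) ≡ length u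
    length-window = begin
      length (take (length u) (drop i w))  ≡⟨ length-take (length u) (drop i w) ⟩
      length u ℕ.⊓ length (drop i w)      ≡⟨ cong (length u ℕ.⊓_) (length-drop i w) ⟩
      length u ℕ.⊓ (length w ∸ i)         ≡⟨ m≤n⇒m⊓n≡m (m+n≤o⇒m≤o∸n (length u) fits) ⟩
      length u                            ∎
      where open ≡-Reasoning
    pointwise : ∀ {k} → k < length (take (length u) (drop i w)) → take (length u) (drop i w) ! k ≡ u ! k
    pointwise k<t = let k<u = subst (_ <_) length-window k<t in
      trans (!-take (length u) (drop i w) k<u) (trans (!-drop i w _) (m k<u))

  occAtℤ⇒matches : ∀ {u x j} → OccAtℤ u x j → Matches u (λ k → x (j ℤ.+ ℤ.+ k))
  occAtℤ⇒matches {u} {x} {j} occ {k} k<u = begin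
    x (j ℤ.+ ℤ.+ k)                  ≡⟨ cong (λ i → x (j ℤ.+ ℤ.+ i)) (toℕ-fromℕ< k<u) ⟨
    x (j ℤ.+ ℤ.+ toℕ (fromℕ< k<u))   ≡⟨ occ (fromℕ< k<u) ⟩
    lookup u (fromℕ< k<u)            ≡⟨ lookup≡! u (fromℕ< k<u) ⟩
    u ! toℕ (fromℕ< k<u)             ≡⟨ cong (u !_) (toℕ-fromℕ< k<u) ⟩
    u ! k                            ∎
    where open ≡-Reasoning

  matches⇒occAtℤ : ∀ {u x j} → Matches u (λ k → x (j ℤ.+ ℤ.+ k)) → OccAtℤ u x j
  matches⇒occAtℤ {u} m k = trans (m (toℕ<n k)) (sym (lookup≡! u k))

  applyUpTo-cong : ∀ {f g : ℕ → A} n → (∀ k → f k ≡ g k) → applyUpTo f n ≡ applyUpTo g n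
  applyUpTo-cong zero    f≗g = refl
  applyUpTo-cong (suc n) f≗g = cong₂ _∷_ (f≗g 0) (applyUpTo-cong n (λ k → f≗g (suc k)))

  applyUpTo-matches : ∀ {u f} → Matches u f → applyUpTo f (length u) ≡ u
  applyUpTo-matches {u} {f} m = !-ext _ u (length-applyUpTo f (length u))
    (λ {k} k<n → let k<u = subst (k <_) (length-applyUpTo f (length u)) k<n in
                 trans (!-applyUpTo f (length u) k<u) (m k<u))

  offset-< : ∀ {n e k L} → k < n → n + e ≤ L → e + k < L
  offset-< {n} {e} {L = L} k<n fits = <-≤-trans (+-monoʳ-< e k<n) (subst (_≤ L) (+-comm n e) fits)

  occAt-applyUpTo : ∀ {u} f {e} L → Matches u (λ k → f (e + k)) → length u + e ≤ L → OccAt u (applyUpTo f L) e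
  occAt-applyUpTo {u} f {e} L m fits =
    matches⇒occAt (subst (length u + e ≤_) (sym (length-applyUpTo f L)) fits)
      (λ k<u → trans (!-applyUpTo f L (offset-< k<u fits)) (m k<u))

  occAt-applyUpTo⁻ : ∀ {u} f {e} L → OccAt u (applyUpTo f L) e → Matches u (λ k → f (e + k))
  occAt-applyUpTo⁻ {u} f {e} L occ k<u =
    trans (sym (!-applyUpTo f L (offset-< k<u (subst (_ ≤_) (length-applyUpTo f L) (proj₂ occ)))))
          (occAt⇒matches occ k<u)

  occAt-++ˡ : ∀ {u w i} v → OccAt u w i → OccAt u (w ++ v) i
  occAt-++ˡ {u} {w} {i} v occ = matches⇒occAt fits′
    (λ k<u → trans (!-++ˡ w v (offset-< k<u (proj₂ occ))) (occAt⇒matches occ k<u))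
    where
    fits′ : length u + i ≤ length (w ++ v)
    fits′ = ≤-trans (proj₂ occ) (subst (length w ≤_) (sym (length-++ w)) (m≤m+n (length w) (length v)))

  occAt-drop : ∀ {u w z} a {i} → a ≤ length w → drop a w ≡ z → OccAt u z i → OccAt u w (a + i)
  occAt-drop {u} {w} {z} a {i} a≤w eq occ = matches⇒occAt fits′ pointwise
    where
    pointwise : Matches u (λ k → w ! (a + i + k))
    pointwise {k} k<u = begin
      w ! (a + i + k)     ≡⟨ cong (w !_) (+-assoc a i k) ⟩
      w ! (a + (i + k))   ≡⟨ !-drop a w (i + k) ⟨
      drop a w ! (i + k)  ≡⟨ cong (_! (i + k)) eq ⟩
      z ! (i + k)         ≡⟨ occAt⇒matches occ k<u ⟩
      u ! k               ∎
      where open ≡-Reasoning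
    fits′ : length u + (a + i) ≤ length w
    fits′ = begin
      length u + (a + i)    ≡⟨ +-comm (length u) (a + i) ⟩
      a + i + length u      ≡⟨ +-assoc a i (length u) ⟩
      a + (i + length u)    ≡⟨ cong (a +_) (+-comm i (length u)) ⟩
      a + (length u + i)    ≤⟨ +-monoʳ-≤ a (proj₂ occ) ⟩
      a + length z          ≡⟨ cong (λ t → a + length t) eq ⟨
      a + length (drop a w) ≡⟨ cong (a +_) (length-drop a w) ⟩
      a + (length w ∸ a)    ≡⟨ m+[n∸m]≡n a≤w ⟩
      length w              ∎
      where open ≤-Reasoning

  drop-++ˡ : ∀ n (u v : List A) → n ≤ length u → drop n (u ++ v) ≡ drop n u ++ v
  drop-++ˡ zero    u       v _         = refl
  drop-++ˡ (suc n) (a ∷ u) v (s≤s n≤u) = drop-++ˡ n u v n≤u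

  HasPeriod : ℕ → List A → Set
  HasPeriod p w = ∀ {s} → p + s < length w → w ! (p + s) ≡ w ! s

  !-+*period : ∀ {p w} → HasPeriod p w → ∀ c s → s + c * p < length w → w ! (s + c * p) ≡ w ! s
  !-+*period {w = w} period zero    s _ = cong (w !_) (+-identityʳ s)
  !-+*period {p} {w} period (suc c) s s+[1+c]p<w = begin
    w ! (s + (p + c * p))   ≡⟨ cong (w !_) (x∙yz≈y∙xz s p (c * p)) ⟩
    w ! (p + (s + c * p))   ≡⟨ period (subst (_< length w) (x∙yz≈y∙xz s p (c * p)) s+[1+c]p<w) ⟩
    w ! (s + c * p)         ≡⟨ !-+*period {p} {w} period c s (≤-<-trans (+-monoʳ-≤ s (m≤n+m (c * p) p)) s+[1+c]p<w) ⟩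
    w ! s                   ∎
    where open ≡-Reasoning

  !-%period : ∀ {p w} .{{_ : NonZero p}} → HasPeriod p w → ∀ {s} → s < length w → w ! (s % p) ≡ w ! s
  !-%period {p} {w} period {s} s<w =
    trans (sym (!-+*period {p} {w} period (s / p) (s % p) (subst (_< length w) s≡s%p+[s/p]*p s<w)))
          (cong (w !_) (sym s≡s%p+[s/p]*p))
    where
    s≡s%p+[s/p]*p : s ≡ s % p + s / p * p
    s≡s%p+[s/p]*p = m≡m%n+[m/n]*n s p


module Overlaps {A : Set} (default : A) (q : List A) where

  open Indexing default

  private
    Q : ℕ
    Q = length q

  overlap-!-prefix : ∀ {z} → IsOverlap q z → Matches q (z !_)
  overlap-!-prefix {z} (pre , _) {k} k<Q = trans (sym (!-take Q z k<Q)) (cong (_! k) pre)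

  overlap-!-suffix : ∀ {z} → IsOverlap q z → ∀ j → z ! (length z ∸ Q + j) ≡ q ! j
  overlap-!-suffix {z} (_ , suf , _) j = trans (sym (!-drop (length z ∸ Q) z j)) (cong (_! j) suf)

  overlap-longer : ∀ {z} → IsOverlap q z → Q < length z
  overlap-longer (_ , _ , q<z , _) = q<z

  overlap-shift>0 : ∀ {z} → IsOverlap q z → 0 < length z ∸ Q
  overlap-shift>0 ov = m<n⇒0<n∸m (overlap-longer ov)

  overlap-shift≤ : ∀ {z} → IsOverlap q z → length z ∸ Q ≤ Q
  overlap-shift≤ {z} (_ , _ , _ , z≤2q) = begin
    length z ∸ Q   ≤⟨ ∸-monoˡ-≤ Q z≤2q ⟩
    2 * Q ∸ Q      ≡⟨ cong (_∸ Q) (cong (Q +_) (+-identityʳ Q)) ⟩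
    Q + Q ∸ Q      ≡⟨ m+n∸m≡n Q Q ⟩
    Q              ∎
    where open ≤-Reasoning

  overlap-length : ∀ {z} → IsOverlap q z → length z ∸ Q + Q ≡ length z
  overlap-length (_ , _ , q<z , _) = m∸n+n≡m (<⇒≤ q<z)

  overlap-occAt-start : ∀ {z} → IsOverlap q z → OccAt q z 0
  overlap-occAt-start {z} ov@(_ , _ , q<z , _) =
    matches⇒occAt (subst (_≤ length z) (sym (+-identityʳ Q)) (<⇒≤ q<z)) (overlap-!-prefix ov)

  overlap-occAt-end : ∀ {z} → IsOverlap q z → OccAt q z (length z ∸ Q)
  overlap-occAt-end {z} ov =
    matches⇒occAt (≤-reflexive (trans (+-comm Q _) (overlap-length ov))) (λ {k} _ → overlap-!-suffix ov k)

  overlap-hasPeriod : ∀ {z} → IsOverlap q z → HasPeriod (length z ∸ Q) z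
  overlap-hasPeriod {z} ov {s} p+s<z = trans (overlap-!-suffix ov s) (sym (overlap-!-prefix ov s<Q))
    where
    s<Q : s < Q
    s<Q = +-cancelˡ-< (length z ∸ Q) s Q (subst (length z ∸ Q + s <_) (sym (overlap-length ov)) p+s<z)

  span-injective : ∀ {z₁ z₂} → span q z₁ ≡ span q z₂ → length z₁ ≡ length z₂
  span-injective eq = ℤ.+-injective (ℤ.neg-injective (∙-cancelˡ (ℤ.+ (2 * Q)) _ _ eq))
    where open import Algebra.Properties.AbelianGroup ℤ.+-0-abelianGroup using (∙-cancelˡ)

  𝒱-unique : ∀ {m z₁ z₂} → 𝒱 q m z₁ → 𝒱 q m z₂ → z₁ ≡ z₂
  𝒱-unique {m} {z₁} {z₂} (ov₁ , span₁) (ov₂ , span₂) = !-ext z₁ z₂ |z₁|≡|z₂| pointwise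
    where
    |z₁|≡|z₂| : length z₁ ≡ length z₂
    |z₁|≡|z₂| = span-injective {z₁} {z₂} (trans span₁ (sym span₂))
    pointwise : ∀ {k} → k < length z₁ → z₁ ! k ≡ z₂ ! k
    pointwise {k} _ with k <? Q
    ... | yes k<Q = trans (overlap-!-prefix ov₁ k<Q) (sym (overlap-!-prefix ov₂ k<Q))
    ... | no  k≮Q = begin
      z₁ ! k                       ≡⟨ cong (z₁ !_) (m+[n∸m]≡n e≤k) ⟨
      z₁ ! (e + (k ∸ e))           ≡⟨ overlap-!-suffix ov₁ (k ∸ e) ⟩
      q ! (k ∸ e)                  ≡⟨ overlap-!-suffix ov₂ (k ∸ e) ⟨
      z₂ ! (length z₂ ∸ Q + (k ∸ e)) ≡⟨ cong (λ n → z₂ ! (n ∸ Q + (k ∸ e))) |z₁|≡|z₂| ⟨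
      z₂ ! (e + (k ∸ e))           ≡⟨ cong (z₂ !_) (m+[n∸m]≡n e≤k) ⟩
      z₂ ! k                       ∎
      where
      open ≡-Reasoning
      e : ℕ
      e = length z₁ ∸ Q
      e≤k : e ≤ k
      e≤k = ≤-trans (overlap-shift≤ ov₁) (≮⇒≥ k≮Q)

  module Concatenation {u v} (ovu : IsOverlap q u) (ovqv : IsOverlap q (q ++ v)) where

    a : ℕ
    a = length u ∸ Q

    b : ℕ
    b = a + length v

    0<a : 0 < a
    0<a = overlap-shift>0 ovu

    |qv|∸Q≡|v| : length (q ++ v) ∸ Q ≡ length v
    |qv|∸Q≡|v| = trans (cong (_∸ Q) (length-++ q)) (m+n∸m≡n Q (length v))

    a<b : a < b
    a<b = m<m+n a (subst (0 <_) |qv|∸Q≡|v| (overlap-shift>0 ovqv))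

    |u|≡Q+a : length u ≡ Q + a
    |u|≡Q+a = trans (sym (overlap-length ovu)) (+-comm a Q)

    |uv|≡Q+b : length (u ++ v) ≡ Q + b
    |uv|≡Q+b = trans (length-++ u) (trans (cong (_+ length v) |u|≡Q+a) (+-assoc Q a (length v)))

    occAt-shift : ∀ {k} → OccAt q (q ++ v) k → OccAt q (u ++ v) (a + k)
    occAt-shift = occAt-drop a a≤|uv| (trans (drop-++ˡ a u v (m∸n≤m (length u) Q)) (cong (_++ v) (proj₁ (proj₂ ovu))))
      where
      a≤|uv| : a ≤ length (u ++ v)
      a≤|uv| = ≤-trans (m∸n≤m (length u) Q) (subst (length u ≤_) (sym (length-++ u)) (m≤m+n (length u) (length v)))

    occAt-0 : OccAt q (u ++ v) 0
    occAt-0 = occAt-++ˡ v (overlap-occAt-start ovu)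

    occAt-a : OccAt q (u ++ v) a
    occAt-a = occAt-++ˡ v (overlap-occAt-end ovu)

    occAt-b : OccAt q (u ++ v) b
    occAt-b = occAt-shift (subst (OccAt q (q ++ v)) |qv|∸Q≡|v| (overlap-occAt-end ovqv))

    occAt-uv≤b : ∀ {k} → OccAt q (u ++ v) k → k ≤ b
    occAt-uv≤b {k} occ = +-cancelˡ-≤ Q k b (subst (Q + k ≤_) |uv|≡Q+b (proj₂ occ))

    occAt-u≤a : ∀ {k} → OccAt q u k → k ≤ a
    occAt-u≤a {k} occ = +-cancelˡ-≤ Q k a (subst (Q + k ≤_) |u|≡Q+a (proj₂ occ))

  𝒱*₂⇒𝒱* : ∀ {m n w} → 𝒱*₂ q m n w → (∃[ u ] 𝒱* q m u) × (∃[ u′ ] 𝒱* q n u′)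
  𝒱*₂⇒𝒱* ((u , v , 𝒱u@(ovu , _) , 𝒱qv@(ovqv , _) , refl) , (i , j , l , i<j , j<l , _ , _ , occ-l , three)) =
    (u , 𝒱u , 0 , a , 0<a , overlap-occAt-start ovu , overlap-occAt-end ovu , occ-u) ,
    (q ++ v , 𝒱qv , 0 , length (q ++ v) ∸ Q , overlap-shift>0 ovqv ,
              overlap-occAt-start ovqv , overlap-occAt-end ovqv , occ-qv)
    where
    open Concatenation ovu ovqv
    members : ∀ k → OccAt q (u ++ v) k → k ≡ 0 ⊎ k ≡ a ⊎ k ≡ b
    members = exactly-three-members i<j j<l occ-l three occAt-0 occAt-a occAt-b 0<a a<b occAt-uv≤b
    occ-u : ∀ k → OccAt q u k → k ≡ 0 ⊎ k ≡ a
    occ-u k occ with members k (occAt-++ˡ v occ)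
    ... | inj₁ k≡0        = inj₁ k≡0
    ... | inj₂ (inj₁ k≡a) = inj₂ k≡a
    ... | inj₂ (inj₂ k≡b) = contradiction (subst (_≤ a) k≡b (occAt-u≤a occ)) (<⇒≱ a<b)
    occ-qv : ∀ k → OccAt q (q ++ v) k → k ≡ 0 ⊎ k ≡ length (q ++ v) ∸ Q
    occ-qv k occ with members (a + k) (occAt-shift occ)
    ... | inj₁ a+k≡0        = inj₁ (m+n≡0⇒n≡0 a a+k≡0)
    ... | inj₂ (inj₁ a+k≡a) = inj₁ (+-cancelˡ-≡ a k 0 (trans a+k≡a (sym (+-identityʳ a))))
    ... | inj₂ (inj₂ a+k≡b) = inj₂ (trans (+-cancelˡ-≡ a k (length v) a+k≡b) (sym |qv|∸Q≡|v|))

  module PeriodicExtension {z} (ov : IsOverlap q z) where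

    period : ℕ
    period = length z ∸ Q

    instance
      period≢0 : NonZero period
      period≢0 = >-nonZero (overlap-shift>0 ov)

    open Residue period public

    extension : ℤ → A
    extension j = z ! residue j

    extension-window : ∀ j {k} → residue j + k < length z → extension (j ℤ.+ ℤ.+ k) ≡ z ! (residue j + k)
    extension-window j {k} lt =
      trans (cong (z !_) (residue-+ j k)) (!-%period {period} {z} (overlap-hasPeriod ov) lt)

    extension-quasiperiod : Quasiperiod q extension
    extension-quasiperiod i = start , ℤ.i-j≤i i (ℤ.+ residue i) , i<i-t+n i t<Q ,
      matches⇒occAtℤ {q} {extension} {start} (λ {k} k<Q → begin
        extension (start ℤ.+ ℤ.+ k)  ≡⟨ extension-window start (subst (λ s → s + k < length z)
                                          (sym start-residue) (<-trans k<Q (overlap-longer ov))) ⟩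
        z ! (residue start + k)      ≡⟨ cong (λ s → z ! (s + k)) start-residue ⟩
        z ! k                        ≡⟨ overlap-!-prefix ov k<Q ⟩
        q ! k                        ∎)
      where
      open ≡-Reasoning
      start : ℤ
      start = i ℤ.- ℤ.+ residue i
      start-residue : residue start ≡ 0
      start-residue = residue[j-residue]≡0 i
      t<Q : residue i < Q
      t<Q = <-≤-trans (residue<p i) (overlap-shift≤ ov)

    extension-occAt : ∀ {u j} → length u ≤ Q → OccAtℤ u extension j → OccAt u z (residue j)
    extension-occAt {u} {j} u≤Q occ = matches⇒occAt {u} {z} fits pointwise
      where
      fits : length u + residue j ≤ length z
      fits = begin
        length u + residue j  ≤⟨ +-mono-≤ u≤Q (<⇒≤ (residue<p j)) ⟩
        Q + period            ≡⟨ +-comm Q period ⟩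
        period + Q            ≡⟨ overlap-length ov ⟩
        length z              ∎
        where open ≤-Reasoning
      pointwise : Matches u (λ k → z ! (residue j + k))
      pointwise {k} k<u = begin
        z ! (residue j + k)      ≡⟨ extension-window j (offset-< k<u fits) ⟨
        extension (j ℤ.+ ℤ.+ k)  ≡⟨ occAtℤ⇒matches {u} {extension} {j} occ k<u ⟩
        u ! k                    ∎
        where open ≡-Reasoning

  occurs⇒definite : ∀ {r} → length r ≤ Q → (∀ x → Quasiperiod q x → ∃[ j ] OccAtℤ r x j) → Definite q r
  occurs⇒definite {r} r≤q occurs m n (_ , 𝒱*₂w) = Product.map occDefined occDefined (𝒱*₂⇒𝒱* 𝒱*₂w)
    where
    occDefined : ∀ {k} → ∃[ z ] 𝒱* q k z → OccDefined q r k
    occDefined (z , 𝒱*z) = residue j , z , 𝒱*z , extension-occAt {r} {j} r≤q (proj₂ occurrence)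
      where
      open PeriodicExtension (proj₁ (proj₁ 𝒱*z))
      occurrence : ∃[ j ] OccAtℤ r extension j
      occurrence = occurs extension extension-quasiperiod
      j : ℤ
      j = proj₁ occurrence

module Forward {A : Set} (_≟_ : DecidableEquality A) (default : A) (q : List A) where

  open Indexing default
  open Overlaps default q

  private
    Q : ℕ
    Q = length q

  OccIn : (ℕ → A) → ℕ → Set
  OccIn g j = Matches q (λ k → g (j + k))

  occIn? : ∀ g j → Dec (OccIn g j)
  occIn? g j = allUpTo? (λ k → g (j + k) ≟ (q ! k)) Q

  -- Positions below |q| may only be covered by occurrences starting left of 0, outside g.
  Covered : (ℕ → A) → Set
  Covered g = ∀ n → Q ≤ n → ∃[ j ] j ≤ n × n < j + Q × OccIn g j

  quasiperiod⇒covered : ∀ {x} → Quasiperiod q x → ∀ a → Covered (λ k → x (ℤ.+ (a + k)))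
  quasiperiod⇒covered {x} qp a n Q≤n with qp (ℤ.+ (a + n))
  ... | ℤ.+ j , ℤ.+≤+ j≤a+n , ℤ.+<+ a+n<j+Q , occ =
    j ∸ a , m≤n+o⇒m∸n≤o j a j≤a+n , n<[j∸a]+Q ,
    matches-cong {q} (λ k → cong (λ i → x (ℤ.+ i)) (sym a+[[j∸a]+k]≡j+k)) (occAtℤ⇒matches {q} {x} {ℤ.+ j} occ)
    where
    a≤j : a ≤ j
    a≤j = <⇒≤ (+-cancelʳ-< Q a j (≤-<-trans (+-monoʳ-≤ a Q≤n) a+n<j+Q))
    a+[[j∸a]+k]≡j+k : ∀ {k} → a + (j ∸ a + k) ≡ j + k
    a+[[j∸a]+k]≡j+k {k} = trans (sym (+-assoc a (j ∸ a) k)) (cong (_+ k) (m+[n∸m]≡n a≤j))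
    n<[j∸a]+Q : n < j ∸ a + Q
    n<[j∸a]+Q = +-cancelˡ-< a n (j ∸ a + Q) (subst (a + n <_) (sym (a+[[j∸a]+k]≡j+k {Q})) a+n<j+Q)
  ... | ℤ.-[1+ t ] , _ , a+n<j+Q , _ =
    contradiction (ℤ.drop‿+<+ (ℤ.<-≤-trans a+n<j+Q (ℤ.m⊖n≤m Q (suc t)))) (≤⇒≯ (≤-trans Q≤n (m≤n+m n a)))

  NextOcc : (ℕ → A) → ℕ → ℕ → Set
  NextOcc g a δ = 0 < δ × δ ≤ Q × OccIn g (a + δ) × (∀ {e} → 0 < e → e < δ → ¬ OccIn g (a + e))

  next-occurrence : ∀ {g} → Covered g → ∀ a → ∃[ δ ] NextOcc g a δ
  next-occurrence {g} covered a with covered (a + Q) (m≤n+m Q a)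
  ... | b , b≤a+Q , a+Q<b+Q , occ-b =
    first (least-witness {P = λ k → OccIn g (suc a + k)} (λ k → occIn? g (suc a + k))
                         (subst (OccIn g) (sym 1+a+[b∸[1+a]]≡b) occ-b))
    where
    1+a+[b∸[1+a]]≡b : suc a + (b ∸ suc a) ≡ b
    1+a+[b∸[1+a]]≡b = m+[n∸m]≡n (+-cancelʳ-< Q a b a+Q<b+Q)
    first : ∃[ m ] OccIn g (suc a + m) × m ≤ b ∸ suc a × (∀ {k} → k < m → ¬ OccIn g (suc a + k)) →
            ∃[ δ ] NextOcc g a δ
    first (m , occ-m , m≤b∸[1+a] , below) =
      suc m , s≤s z≤n , 1+m≤Q , subst (OccIn g) (sym (+-suc a m)) occ-m , none-before
      where
      1+m≤Q : suc m ≤ Q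
      1+m≤Q = +-cancelˡ-≤ a (suc m) Q (begin
        a + suc m              ≡⟨ +-suc a m ⟩
        suc a + m              ≤⟨ +-monoʳ-≤ (suc a) m≤b∸[1+a] ⟩
        suc a + (b ∸ suc a)    ≡⟨ 1+a+[b∸[1+a]]≡b ⟩
        b                      ≤⟨ b≤a+Q ⟩
        a + Q                  ∎)
        where open ≤-Reasoning
      none-before : ∀ {e} → 0 < e → e < suc m → ¬ OccIn g (a + e)
      none-before {suc e} _ (s≤s e<m) occ-e = below e<m (subst (OccIn g) (+-suc a e) occ-e)

  applyUpTo-overlap : ∀ g {δ} → OccIn g 0 → OccIn g δ → 0 < δ → δ ≤ Q → IsOverlap q (applyUpTo g (δ + Q))
  applyUpTo-overlap g {δ} occ₀ occ-δ 0<δ δ≤Q = prefix , suffix , q<z , z≤2q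
    where
    z : List A
    z = applyUpTo g (δ + Q)
    |z|≡δ+Q : length z ≡ δ + Q
    |z|≡δ+Q = length-applyUpTo g (δ + Q)
    prefix : take Q z ≡ q
    prefix = proj₁ (occAt-applyUpTo g (δ + Q) occ₀ (subst (_≤ δ + Q) (sym (+-identityʳ Q)) (m≤n+m Q δ)))
    |drop-δ-z|≡Q : length (drop δ z) ≡ Q
    |drop-δ-z|≡Q = trans (length-drop δ z) (trans (cong (_∸ δ) |z|≡δ+Q) (m+n∸m≡n δ Q))
    suffix : drop (length z ∸ Q) z ≡ q
    suffix = begin
      drop (length z ∸ Q) z       ≡⟨ cong (λ e → drop e z) (trans (cong (_∸ Q) |z|≡δ+Q) (m+n∸n≡m δ Q)) ⟩
      drop δ z                    ≡⟨ take-all Q (drop δ z) (≤-reflexive |drop-δ-z|≡Q) ⟨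
      take Q (drop δ z)           ≡⟨ proj₁ (occAt-applyUpTo g (δ + Q) occ-δ (≤-reflexive (+-comm Q δ))) ⟩
      q                           ∎
      where open ≡-Reasoning
    q<z : Q < length z
    q<z = subst (Q <_) (sym |z|≡δ+Q) (+-monoˡ-< Q 0<δ)
    z≤2q : length z ≤ 2 * Q
    z≤2q = subst₂ _≤_ (sym |z|≡δ+Q) (cong (Q +_) (sym (+-identityʳ Q))) (+-monoˡ-≤ Q δ≤Q)

  consecutive-occurrences : ∀ {g δ₁ δ₂} → NextOcc g 0 δ₁ → NextOcc g δ₁ δ₂ →
                            ∀ l → OccIn g l → l ≤ δ₁ + δ₂ → l ≡ 0 ⊎ l ≡ δ₁ ⊎ l ≡ δ₁ + δ₂
  consecutive-occurrences {g} {δ₁} {δ₂} (_ , _ , _ , none₁) (_ , _ , _ , none₂) l occ l≤δ₁+δ₂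
    with <-cmp l δ₁
  ... | tri< l<δ₁ _ _ = inj₁ (before-first l l<δ₁ occ)
    where
    before-first : ∀ l → l < δ₁ → OccIn g l → l ≡ 0
    before-first zero    _    _     = refl
    before-first (suc l) l<δ₁ occ-l = ⊥-elim (none₁ (s≤s z≤n) l<δ₁ occ-l)
  ... | tri≈ _ l≡δ₁ _ = inj₂ (inj₁ l≡δ₁)
  ... | tri> _ _ δ₁<l = inj₂ (inj₂ (trans (sym δ₁+e≡l) (cong (δ₁ +_) e≡δ₂)))
    where
    e : ℕ
    e = l ∸ δ₁
    δ₁+e≡l : δ₁ + e ≡ l
    δ₁+e≡l = m+[n∸m]≡n (<⇒≤ δ₁<l)
    e≡δ₂ : e ≡ δ₂
    e≡δ₂ with <-cmp e δ₂
    ... | tri< e<δ₂ _ _ = ⊥-elim (none₂ (m<n⇒0<n∸m δ₁<l) e<δ₂ (subst (OccIn g) (sym δ₁+e≡l) occ))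
    ... | tri≈ _ e≡δ₂ _ = e≡δ₂
    ... | tri> _ _ δ₂<e = contradiction (subst (_≤ δ₁ + δ₂) (sym δ₁+e≡l) l≤δ₁+δ₂) (<⇒≱ (+-monoʳ-< δ₁ δ₂<e))

  consecutive⇒𝒱*₂ : ∀ g {δ₁ δ₂} → OccIn g 0 → NextOcc g 0 δ₁ → NextOcc g δ₁ δ₂ →
                    ∃[ n ] 𝒱*₂ q (span q (applyUpTo g (δ₁ + Q))) n (applyUpTo g (δ₁ + Q + δ₂))
  consecutive⇒𝒱*₂ g {δ₁} {δ₂} occ₀ next₁@(0<δ₁ , δ₁≤Q , occ₁ , _) next₂@(0<δ₂ , δ₂≤Q , occ₂ , _) =
    span q (q ++ v) ,
    (u , v , (applyUpTo-overlap g occ₀ occ₁ 0<δ₁ δ₁≤Q , refl) , (overlap-qv , refl) , applyUpTo-++ g (δ₁ + Q) δ₂) ,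
    (0 , δ₁ , δ₁ + δ₂ , 0<δ₁ , m<m+n δ₁ 0<δ₂ ,
     occAt-applyUpTo g L occ₀ (fits z≤n) , occAt-applyUpTo g L occ₁ (fits (m≤m+n δ₁ δ₂)) ,
     occAt-applyUpTo g L occ₂ (fits ≤-refl) , only-three)
    where
    u : List A
    u = applyUpTo g (δ₁ + Q)
    v : List A
    v = applyUpTo (λ k → g (δ₁ + Q + k)) δ₂
    L : ℕ
    L = δ₁ + Q + δ₂
    L≡Q+[δ₁+δ₂] : L ≡ Q + (δ₁ + δ₂)
    L≡Q+[δ₁+δ₂] = trans (cong (_+ δ₂) (+-comm δ₁ Q)) (+-assoc Q δ₁ δ₂)
    fits : ∀ {e} → e ≤ δ₁ + δ₂ → Q + e ≤ L
    fits {e} e≤ = subst (Q + e ≤_) (sym L≡Q+[δ₁+δ₂]) (+-monoʳ-≤ Q e≤)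
    g′ : ℕ → A
    g′ k = g (δ₁ + k)
    g′-window : applyUpTo g′ (δ₂ + Q) ≡ q ++ v
    g′-window = begin
      applyUpTo g′ (δ₂ + Q)                                  ≡⟨ cong (applyUpTo g′) (+-comm δ₂ Q) ⟩
      applyUpTo g′ (Q + δ₂)                                  ≡⟨ applyUpTo-++ g′ Q δ₂ ⟩
      applyUpTo g′ Q ++ applyUpTo (λ k → g (δ₁ + (Q + k))) δ₂ ≡⟨ cong₂ _++_ (applyUpTo-matches occ₁)
                                                                 (applyUpTo-cong δ₂ (λ k → cong g (sym (+-assoc δ₁ Q k)))) ⟩
      q ++ v                                                 ∎
      where open ≡-Reasoning
    overlap-qv : IsOverlap q (q ++ v)
    overlap-qv = subst (IsOverlap q) g′-window
      (applyUpTo-overlap g′ occ₁ (matches-cong {q} (λ k → cong g (+-assoc δ₁ δ₂ k)) occ₂) 0<δ₂ δ₂≤Q)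
    only-three : ∀ l → OccAt q (applyUpTo g L) l → l ≡ 0 ⊎ l ≡ δ₁ ⊎ l ≡ δ₁ + δ₂
    only-three l occ = consecutive-occurrences {g} next₁ next₂ l (occAt-applyUpTo⁻ {q} g L occ)
      (+-cancelˡ-≤ Q l (δ₁ + δ₂) (subst (Q + l ≤_) (trans (length-applyUpTo g L) L≡Q+[δ₁+δ₂]) (proj₂ occ)))

  module _ (r : List A) (definite : Definite q r) {x : ℤ → A} (qp : Quasiperiod q x) where

    occurs-after : ∀ b → OccIn (λ k → x (ℤ.+ (b + k))) 0 → ∃[ i ] OccAtℤ r x (ℤ.+ (b + i))
    occurs-after b occ₀ =
      i , matches⇒occAtℤ {r} {x} {ℤ.+ (b + i)}
            (matches-cong {r} (λ k → cong (λ t → x (ℤ.+ t)) (sym (+-assoc b i k))) (occAt-applyUpTo⁻ {r} g (δ₁ + Q) occ-u))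
      where
      g : ℕ → A
      g k = x (ℤ.+ (b + k))
      covered : Covered g
      covered = quasiperiod⇒covered {x} qp b
      δ₁ : ℕ
      δ₁ = proj₁ (next-occurrence {g} covered 0)
      next₁ : NextOcc g 0 δ₁
      next₁ = proj₂ (next-occurrence {g} covered 0)
      δ₂ : ℕ
      δ₂ = proj₁ (next-occurrence {g} covered δ₁)
      next₂ : NextOcc g δ₁ δ₂
      next₂ = proj₂ (next-occurrence {g} covered δ₁)
      𝒱u : 𝒱 q (span q (applyUpTo g (δ₁ + Q))) (applyUpTo g (δ₁ + Q))
      𝒱u = applyUpTo-overlap g occ₀ (proj₁ (proj₂ (proj₂ next₁))) (proj₁ next₁) (proj₁ (proj₂ next₁)) , refl
      defined : OccDefined q r (span q (applyUpTo g (δ₁ + Q)))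
      defined = proj₁ (definite _ _ (_ , proj₂ (consecutive⇒𝒱*₂ g occ₀ next₁ next₂)))
      i : ℕ
      i = proj₁ defined
      occ-u : OccAt r (applyUpTo g (δ₁ + Q)) i
      occ-u = subst (λ w → OccAt r w i) (𝒱-unique (proj₁ (proj₁ (proj₂ (proj₂ defined)))) 𝒱u)
                    (proj₂ (proj₂ (proj₂ defined)))

    definite⇒infinitelyMany : InfinitelyManyOcc r x
    definite⇒infinitelyMany N = ℤ.+ (N + j + i) , ≤-trans (m≤m+n N j) (m≤m+n (N + j) i) , proj₂ after
      where
      covering : ∃[ j ] j ≤ Q × Q < j + Q × OccIn (λ k → x (ℤ.+ (N + k))) j
      covering = quasiperiod⇒covered {x} qp N Q ≤-refl
      j : ℕ
      j = proj₁ covering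
      after : ∃[ i ] OccAtℤ r x (ℤ.+ (N + j + i))
      after = occurs-after (N + j)
        (matches-cong {q} (λ k → cong (λ t → x (ℤ.+ t)) (sym (+-assoc N j k))) (proj₂ (proj₂ (proj₂ covering))))
      i : ℕ
      i = proj₁ after

proposition16 : {A : Set} → DecidableEquality A → (q r : List A) →
    0 < length q → length q ≡ length r →
    (Definite q r ⇔ (∀ (x : Data.Integer.ℤ → A) → Quasiperiod q x → InfinitelyManyOcc r x))
proposition16 _   []        _ () _
proposition16 _≟_ q@(a ∷ _) r _  |q|≡|r| = mk⇔
  (λ definite x → Forward.definite⇒infinitelyMany _≟_ a q r definite {x})
  (λ infinitelyMany → Overlaps.occurs⇒definite a q (≤-reflexive (sym |q|≡|r|))
    (λ x qp → let j , _ , occ = infinitelyMany x qp 0 in j , occ))
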